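{- For $\mathbf{t}, \mathbf{k}\in \mathbb{N}_0^{(\infty)}$, we have $$ \langle \mathsf{S}^{(\mathbf{t})},\mathsf{M}^{(\mathbf{k})}\rangle=\delta_{\mathbf{t}}^{\mathbf{k}}, $$ where $\delta_{\mathbf{t}}^{\mathbf{k}}$ is the Kronecker symbol, equal to $0$ if $\mathbf{t}\ne\mathbf{k}$ and $1$ if $\mathbf{t}=\mathbf{k}$.
   Context: Let $R$ be a commutative integral domain of characteristic 0 and $R\langle X,Y\rangle$ the free associative algebra over $R$ on two non-commuting letters $X,Y$, with $[u,v]=uv-vu$. Set $Y^{(0)}=Y$, $Y^{(k+1)}=[X,Y^{(k)}]$ for $k\ge 0$. Let $\mathbb{N}_0$ be the non-negative integers and $\mathbb{N}_0^{(\infty)}$ the set of finite sequences $\mathbf{k}=(k_1,\dots,k_d;k_\infty)$ of non-negative integers with $d\ge 0$ and a special last entry $k_\infty\in\mathbb{N}_0$. For such $\mathbf{k}$, the Magnus polynomial is $\mathsf{M}^{(\mathbf{k})}=Y^{(k_1)}\cdots Y^{(k_d)}X^{k_\infty}$ (with $\mathsf{M}^{(;k)}=X^k$), and the demi-shuffle polynomial is $\mathsf{S}^{(\mathbf{k})}=(\cdots((X^{k_1}Y)\,\text{ш}\, X^{k_2})Y)\,\text{ш}\cdots\text{ш}\, X^{k_d})Y)\,\text{ш}\, X^{k_\infty}$, where ш denotes the usual shuffle product (with $\mathsf{S}^{(;k)}=X^k$). The pairing $\langle\ ,\ \rangle$ is the standard $R$-bilinear pairing on $R\langle X,Y\rangle$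 for which the words (monomials in $X,Y$, including $1$) form an orthonormal basis, i.e. $\langle w,w'\rangle=\delta_w^{w'}$ for words $w,w'$. -}

module Defs where

open import Level using (Level)
open import Algebra.Bundles using (CommutativeRing)
open import Data.Nat using (ℕ; zero; suc)
open import Data.List using (List; []; _∷_; _++_; map; concatMap; foldl; replicate)
open import Data.Product using (_×_; _,_)
open import Data.Empty using (⊥)
open import Relation.Nullary using (¬_; Dec; yes; no)
open import Relation.Binary.PropositionalEquality using (_≡_; refl)
import Data.List.Properties as LP
import Data.Product.Properties as PP
import Data.Nat.Properties as NP

data Letter : Set where
  X Y : Letter

_≟L_ : (a b : Letter) → Dec (a ≡ b)
X ≟L X = yes refl
X ≟L Y = no λ ()
Y ≟L X = no λ ()
Y ≟L Y = yes refl

Word : Set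
Word = List Letter

_≟W_ : (u v : Word) → Dec (u ≡ v)
_≟W_ = LP.≡-dec _≟L_

-- Shuffle of two words, as the list (multiset) of resulting words, each with coefficient 1.
shuffleW : Word → Word → List Word
shuffleW [] v = v ∷ []
shuffleW (a ∷ u) [] = (a ∷ u) ∷ []
shuffleW (a ∷ u) (b ∷ v) =
  map (a ∷_) (shuffleW u (b ∷ v)) ++ map (b ∷_) (shuffleW (a ∷ u) v)

-- Indices in N_0^(∞): (k_1,...,k_d ; k_∞) with d ≥ 0.
Index : Set
Index = List ℕ × ℕ

_≟I_ : (s t : Index) → Dec (s ≡ t)
_≟I_ = PP.≡-dec (LP.≡-dec NP._≟_) NP._≟_

Xpow : ℕ → Word
Xpow k = replicate k X

module _ {c ℓ : Level} (R : CommutativeRing c ℓ) where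
  open CommutativeRing R

  IsIntegralDomain : Set _
  IsIntegralDomain =
    (¬ (1# ≈ 0#)) × (∀ a b → a * b ≈ 0# → (a ≈ 0#) Data.Sum.⊎ (b ≈ 0#))
    where import Data.Sum

  natR : ℕ → Carrier
  natR zero = 0#
  natR (suc n) = 1# + natR n

  HasCharZero : Set _
  HasCharZero = ∀ n → ¬ (natR (suc n) ≈ 0#)

  -- Elements of R<X,Y> as formal finite R-linear combinations of words.
  Poly : Set c
  Poly = List (Carrier × Word)

  one : Poly
  one = (1# , []) ∷ []

  word : Word → Poly
  word w = (1# , w) ∷ []

  _⊕_ : Poly → Poly → Poly
  p ⊕ q = p ++ q

  neg : Poly → Poly
  neg = map (λ { (a , w) → (- a , w) })

  _⊗_ : Poly → Poly → Poly
  p ⊗ q = concatMap (λ { (a , u) → map (λ { (b , v) → (a * b , u ++ v) }) q }) p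

  ⟦_,_⟧ : Poly → Poly → Poly
  ⟦ p , q ⟧ = (p ⊗ q) ⊕ neg (q ⊗ p)

  _ш_ : Poly → Poly → Poly
  p ш q = concatMap (λ { (a , u) → concatMap (λ { (b , v) →
            map (λ w → (a * b , w)) (shuffleW u v) }) q }) p

  Yder : ℕ → Poly
  Yder zero = word (Y ∷ [])
  Yder (suc k) = ⟦ word (X ∷ []) , Yder k ⟧

  Magnus : Index → Poly
  Magnus (ks , k∞) = go ks
    where
    go : List ℕ → Poly
    go [] = word (Xpow k∞)
    go (k ∷ ks') = Yder k ⊗ go ks'

  -- demi-shuffle polynomial
  -- S^(k) = (...((X^{k_1} Y) ш X^{k_2}) Y ... ш X^{k_d}) Y) ш X^{k_∞},
  -- computed as P_0 = 1, P_i = (P_{i-1} ш X^{k_i}) Y, S = P_d ш X^{k_∞}.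
  DemiShuffle : Index → Poly
  DemiShuffle (ks , k∞) =
    foldl (λ P k → (P ш word (Xpow k)) ⊗ word (Y ∷ [])) one ks ш word (Xpow k∞)

  δW : Word → Word → Carrier
  δW u v with u ≟W v
  ... | yes _ = 1#
  ... | no _ = 0#

  sumR : List Carrier → Carrier
  sumR [] = 0#
  sumR (a ∷ as) = a + sumR as

  ⟪_,_⟫ : Poly → Poly → Carrier
  ⟪ p , q ⟫ = sumR (concatMap (λ { (a , u) → map (λ { (b , v) → a * b * δW u v }) q }) p)

  δI : Index → Index → Carrier
  δI s t with s ≟I t
  ... | yes _ = 1#
  ... | no _ = 0#

{-# OPTIONS --safe #-}
-- Identify a polynomial with its coefficient series Word → R, so that the pairing becomes
-- evaluation ⟨ f , q ⟩ and S^(t) becomes a series built with the left derivatives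
-- (∂_a f)(w) = f(a w). The shuffle obeys the Leibniz rule ∂_a(f ⧢ g) = ∂_a f ⧢ g + f ⧢ ∂_a g,
-- whence ∂_Y S^(t₁,…;m) = [t₁ = 0] S^(…;m), ∂_Y S^(;m) = 0, and ∂_X S^(t) = Σ S^(t′) over
-- the t′ obtained from t by lowering one entry by one.  Writing p ⊳ f for the transpose of
-- left multiplication by p, the relations Y^(0) = Y and Y^(k+1) = X Y^(k) − Y^(k) X turn
-- these rules, by induction on k, into Y^(k) ⊳ S^(t₁,…;m) = [t₁ = k] S^(…;m) and
-- Y^(k) ⊳ S^(;m) = 0.  Peeling off the factors of M^(k) = Y^(k₁)⋯Y^(k_d) X^(k_∞) one at a
-- time leaves ⟨S^(t), X^n⟩, which is [t = (;n)] because every word occurring in S^(t)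
-- contains Y as soon as d ≥ 1.
module Submission where

open import Defs
open import Level using (Level; _⊔_)
open import Algebra.Bundles using (CommutativeRing)
open import Data.Nat using (ℕ; zero; suc)
open import Data.Nat.Properties using (_≟_; suc-injective)
open import Data.List using (List; []; _∷_; _++_; map; concatMap; foldl; length)
open import Data.List.Properties using (∷-injective; ++-assoc; length-replicate)
open import Data.Product using (_×_; _,_; proj₁; proj₂)
open import Data.Empty using (⊥-elim)
open import Function using (_∘_)
open import Function.Bundles using (_⇔_; mk⇔; Equivalence)
open import Relation.Nullary using (yes; no)
open import Relation.Binary.Bundles using (Setoid)
open import Relation.Binary.Definitions using (DecidableEquality)
open import Relation.Binary.PropositionalEquality as ≡ using (_≡_; _≢_)
import Relation.Binary.Reasoning.Setoid as SetoidReasoning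

module _ {c ℓ : Level} (R : CommutativeRing c ℓ) where
  open CommutativeRing R hiding (zero)
  open import Algebra.Properties.Ring ring using (-‿distribʳ-*)
  open import Algebra.Properties.AbelianGroup +-abelianGroup using (⁻¹-∙-comm; ε⁻¹≈ε)
  open import Algebra.Properties.CommutativeSemigroup +-commutativeSemigroup
    using (interchange)
  open import Algebra.Properties.CommutativeSemigroup *-commutativeSemigroup
    using (x∙yz≈y∙xz; xy∙z≈xz∙y)
  module ≈-Reasoning = SetoidReasoning setoid

  -- Opaque so that kron is not unfolded during unification; otherwise the implicit
  -- arguments of the lemmas below cannot be inferred.
  opaque
    kron : {A : Set} → DecidableEquality A → A → A → Carrier
    kron eq? x y with eq? x y
    ... | yes _ = 1#
    ... | no _ = 0#

    kron-≡ : {A : Set} {eq? : DecidableEquality A} {x y : A} → x ≡ y → kron eq? x y ≈ 1#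
    kron-≡ {eq? = eq?} {x} {y} x≡y with eq? x y
    ... | yes _ = refl
    ... | no x≢y = ⊥-elim (x≢y x≡y)

    kron-≢ : {A : Set} {eq? : DecidableEquality A} {x y : A} → x ≢ y → kron eq? x y ≈ 0#
    kron-≢ {eq? = eq?} {x} {y} x≢y with eq? x y
    ... | yes x≡y = ⊥-elim (x≢y x≡y)
    ... | no _ = refl

  kron-refl : {A : Set} {eq? : DecidableEquality A} (x : A) → kron eq? x x ≈ 1#
  kron-refl x = kron-≡ ≡.refl

  kron-cong : {A B : Set} {eqA : DecidableEquality A} {eqB : DecidableEquality B}
              {x y : A} {x′ y′ : B} → (x ≡ y ⇔ x′ ≡ y′) → kron eqA x y ≈ kron eqB x′ y′
  kron-cong {eqA = eqA} {x = x} {y} x≡y⇔x′≡y′ with eqA x y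
  ... | yes x≡y = trans (kron-≡ x≡y) (sym (kron-≡ (Equivalence.to x≡y⇔x′≡y′ x≡y)))
  ... | no x≢y = trans (kron-≢ x≢y) (sym (kron-≢ (x≢y ∘ Equivalence.from x≡y⇔x′≡y′)))

  kron-injective₂ : {A B C : Set} {eqA : DecidableEquality A} {eqB : DecidableEquality B}
                    {eqC : DecidableEquality C} (f : A → B → C) →
                    (∀ {x y x′ y′} → f x y ≡ f x′ y′ → x ≡ x′ × y ≡ y′) →
                    ∀ x y x′ y′ → kron eqC (f x y) (f x′ y′) ≈ kron eqA x x′ * kron eqB y y′
  kron-injective₂ {eqA = eqA} f f-injective x y x′ y′ with eqA x x′
  ... | yes ≡.refl = trans
          (kron-cong (mk⇔ (proj₂ ∘ f-injective) (≡.cong (f x))))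
          (sym (trans (*-congʳ (kron-refl x)) (*-identityˡ _)))
  ... | no x≢x′ = trans (kron-≢ (x≢x′ ∘ proj₁ ∘ f-injective))
                    (sym (trans (*-congʳ (kron-≢ x≢x′)) (zeroˡ _)))

  opaque
    unfolding kron

    δW≡kron : ∀ u v → δW R u v ≡ kron _≟W_ u v
    δW≡kron u v with u ≟W v
    ... | yes _ = ≡.refl
    ... | no _ = ≡.refl

    δI≡kron : ∀ s t → δI R s t ≡ kron _≟I_ s t
    δI≡kron s t with s ≟I t
    ... | yes _ = ≡.refl
    ... | no _ = ≡.refl

  Series : Set c
  Series = Word → Carrier

  infix 4 _≋_
  _≋_ : Series → Series → Set ℓ
  f ≋ g = ∀ w → f w ≈ g w

  ≋-setoid : Setoid c ℓ
  ≋-setoid = record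
    { _≈_ = _≋_
    ; isEquivalence = record
      { refl = λ _ → refl
      ; sym = λ f≋g w → sym (f≋g w)
      ; trans = λ f≋g g≋h w → trans (f≋g w) (g≋h w)
      }
    }
  module ≋-Reasoning = SetoidReasoning ≋-setoid

  0ˢ : Series
  0ˢ _ = 0#

  infixl 6 _+ˢ_
  _+ˢ_ : Series → Series → Series
  (f +ˢ g) w = f w + g w

  infixr 7 _·ˢ_
  _·ˢ_ : Carrier → Series → Series
  (a ·ˢ f) w = a * f w

  ∂ : Letter → Series → Series
  ∂ a f w = f (a ∷ w)

  δ : Word → Series
  δ = kron _≟W_

  ∑ : ∀ {a} {A : Set a} → List A → (A → Series) → Series
  ∑ [] h = 0ˢ
  ∑ (x ∷ xs) h = h x +ˢ ∑ xs h

  ∑-cong : ∀ {a} {A : Set a} (L : List A) {h h′ : A → Series} →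
           (∀ x → h x ≋ h′ x) → ∑ L h ≋ ∑ L h′
  ∑-cong [] h≋h′ w = refl
  ∑-cong (x ∷ L) h≋h′ w = +-cong (h≋h′ x w) (∑-cong L h≋h′ w)

  ∑-++ : ∀ {a} {A : Set a} (L L′ : List A) (h : A → Series) →
         ∑ (L ++ L′) h ≋ ∑ L h +ˢ ∑ L′ h
  ∑-++ [] L′ h w = sym (+-identityˡ _)
  ∑-++ (x ∷ L) L′ h w = trans (+-congˡ (∑-++ L L′ h w)) (sym (+-assoc _ _ _))

  ∑-map : ∀ {a b} {A : Set a} {B : Set b} (g : A → B) (L : List A) (h : B → Series) →
          ∑ (map g L) h ≋ ∑ L (h ∘ g)
  ∑-map g [] h w = refl
  ∑-map g (x ∷ L) h w = +-congˡ (∑-map g L h w)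

  ∑-concatMap : ∀ {a b} {A : Set a} {B : Set b} (g : A → List B) (L : List A) (h : B → Series) →
                ∑ (concatMap g L) h ≋ ∑ L (λ x → ∑ (g x) h)
  ∑-concatMap g [] h w = refl
  ∑-concatMap g (x ∷ L) h w =
    trans (∑-++ (g x) (concatMap g L) h w) (+-congˡ (∑-concatMap g L h w))

  record IsLinear (T : Series → Series) : Set (c ⊔ ℓ) where
    field
      cong : ∀ {f g} → f ≋ g → T f ≋ T g
      +-hom : ∀ f g → T (f +ˢ g) ≋ T f +ˢ T g
      ·-hom : ∀ a f → T (a ·ˢ f) ≋ a ·ˢ T f

    0-hom : T 0ˢ ≋ 0ˢ
    0-hom w = trans (cong (λ _ → sym (zeroˡ 0#)) w) (trans (·-hom 0# 0ˢ w) (zeroˡ _))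

    cong-0 : ∀ {f} → f ≋ 0ˢ → T f ≋ 0ˢ
    cong-0 f≋0 w = trans (cong f≋0 w) (0-hom w)

    ∑-hom : ∀ {a} {A : Set a} (L : List A) (h : A → Series) → T (∑ L h) ≋ ∑ L (T ∘ h)
    ∑-hom [] h = 0-hom
    ∑-hom (x ∷ L) h w = trans (+-hom (h x) (∑ L h) w) (+-congˡ (∑-hom L h w))

  open IsLinear

  ∘-linear : ∀ {T U} → IsLinear T → IsLinear U → IsLinear (T ∘ U)
  ∘-linear T U = record
    { cong = cong T ∘ cong U
    ; +-hom = λ f g w → trans (cong T (+-hom U f g) w) (+-hom T _ _ w)
    ; ·-hom = λ a f w → trans (cong T (·-hom U a f) w) (·-hom T a _ w)
    }

  ∂-linear : ∀ a → IsLinear (∂ a)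
  ∂-linear a = record
    { cong = λ f≋g w → f≋g (a ∷ w)
    ; +-hom = λ _ _ _ → refl
    ; ·-hom = λ _ _ _ → refl
    }

  ·ˢ-linear : ∀ a → IsLinear (a ·ˢ_)
  ·ˢ-linear a = record
    { cong = λ f≋g w → *-congˡ (f≋g w)
    ; +-hom = λ _ _ _ → distribˡ a _ _
    ; ·-hom = λ b _ _ → x∙yz≈y∙xz a b _
    }

  ∂-δ[] : ∀ a → ∂ a (δ []) ≋ 0ˢ
  ∂-δ[] a w = kron-≢ λ ()

  ∂-δ : ∀ a b u → ∂ a (δ (b ∷ u)) ≋ kron _≟L_ b a ·ˢ δ u
  ∂-δ a b u w = kron-injective₂ _∷_ ∷-injective b u a w

  infixr 7 _⧢_
  _⧢_ : Series → Series → Series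
  (f ⧢ g) [] = f [] * g []
  (f ⧢ g) (a ∷ w) = (∂ a f ⧢ g) w + (f ⧢ ∂ a g) w

  ⧢-cong : ∀ {f f′ g g′} → f ≋ f′ → g ≋ g′ → f ⧢ g ≋ f′ ⧢ g′
  ⧢-cong f≋f′ g≋g′ [] = *-cong (f≋f′ []) (g≋g′ [])
  ⧢-cong f≋f′ g≋g′ (a ∷ w) =
    +-cong (⧢-cong (f≋f′ ∘ (a ∷_)) g≋g′ w) (⧢-cong f≋f′ (g≋g′ ∘ (a ∷_)) w)

  ⧢-linearˡ : ∀ g → IsLinear (_⧢ g)
  ⧢-linearˡ g = record
    { cong = λ f≋f′ → ⧢-cong f≋f′ λ _ → refl
    ; +-hom = λ f f′ → hom-+ f f′ g
    ; ·-hom = λ a f → hom-· a f g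
    }
    where
    hom-+ : ∀ f f′ g → (f +ˢ f′) ⧢ g ≋ f ⧢ g +ˢ f′ ⧢ g
    hom-+ f f′ g [] = distribʳ _ _ _
    hom-+ f f′ g (a ∷ w) =
      trans (+-cong (hom-+ _ _ g w) (hom-+ f f′ (∂ a g) w)) (interchange _ _ _ _)
    hom-· : ∀ b f g → (b ·ˢ f) ⧢ g ≋ b ·ˢ (f ⧢ g)
    hom-· b f g [] = *-assoc _ _ _
    hom-· b f g (a ∷ w) =
      trans (+-cong (hom-· b _ g w) (hom-· b f (∂ a g) w)) (sym (distribˡ b _ _))

  ⧢-linearʳ : ∀ f → IsLinear (f ⧢_)
  ⧢-linearʳ f = record
    { cong = ⧢-cong λ _ → refl
    ; +-hom = λ g g′ → hom-+ f g g′
    ; ·-hom = λ a g → hom-· a f g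
    }
    where
    hom-+ : ∀ f g g′ → f ⧢ (g +ˢ g′) ≋ f ⧢ g +ˢ f ⧢ g′
    hom-+ f g g′ [] = distribˡ _ _ _
    hom-+ f g g′ (a ∷ w) =
      trans (+-cong (hom-+ (∂ a f) g g′ w) (hom-+ f _ _ w)) (interchange _ _ _ _)
    hom-· : ∀ b f g → f ⧢ (b ·ˢ g) ≋ b ·ˢ (f ⧢ g)
    hom-· b f g [] = x∙yz≈y∙xz _ b _
    hom-· b f g (a ∷ w) =
      trans (+-cong (hom-· b (∂ a f) g w) (hom-· b f _ w)) (sym (distribˡ b _ _))

  ⧢-identityˡ : ∀ g → δ [] ⧢ g ≋ g
  ⧢-identityˡ g [] = trans (*-congʳ (kron-refl [])) (*-identityˡ _)
  ⧢-identityˡ g (a ∷ w) = trans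
    (+-cong (cong-0 (⧢-linearˡ g) (∂-δ[] a) w)
            (⧢-identityˡ (∂ a g) w))
    (+-identityˡ _)

  ⧢-identityʳ : ∀ f → f ⧢ δ [] ≋ f
  ⧢-identityʳ f [] = trans (*-congˡ (kron-refl [])) (*-identityʳ _)
  ⧢-identityʳ f (a ∷ w) = trans
    (+-cong (⧢-identityʳ (∂ a f) w)
            (cong-0 (⧢-linearʳ f) (∂-δ[] a) w))
    (+-identityʳ _)

  ∂-∑-prefixed : ∀ a b L → ∂ a (∑ (map (b ∷_) L) δ) ≋ kron _≟L_ b a ·ˢ ∑ L δ
  ∂-∑-prefixed a b L = begin
    ∂ a (∑ (map (b ∷_) L) δ)              ≈⟨ ∑-hom (∂-linear a) (map (b ∷_) L) δ ⟩
    ∑ (map (b ∷_) L) (∂ a ∘ δ)            ≈⟨ ∑-map (b ∷_) L (∂ a ∘ δ) ⟩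
    ∑ L (λ u → ∂ a (δ (b ∷ u)))           ≈⟨ ∑-cong L (∂-δ a b) ⟩
    ∑ L (λ u → kron _≟L_ b a ·ˢ δ u)      ≈⟨ ∑-hom (·ˢ-linear _) L δ ⟨
    kron _≟L_ b a ·ˢ ∑ L δ                ∎
    where open ≋-Reasoning

  ∑-prefixed-[] : ∀ b L → ∑ (map (b ∷_) L) δ [] ≈ 0#
  ∑-prefixed-[] b [] = refl
  ∑-prefixed-[] b (u ∷ L) = trans (+-cong (kron-≢ λ ()) (∑-prefixed-[] b L)) (+-identityʳ 0#)

  ∑-shuffleW : ∀ u v → ∑ (shuffleW u v) δ ≋ δ u ⧢ δ v
  ∑-shuffleW [] v w = trans (+-identityʳ _) (sym (⧢-identityˡ (δ v) w))
  ∑-shuffleW (a ∷ u) [] w = trans (+-identityʳ _) (sym (⧢-identityʳ (δ (a ∷ u)) w))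
  ∑-shuffleW (a ∷ u) (b ∷ v) [] = begin
    ∑ (map (a ∷_) S₁ ++ map (b ∷_) S₂) δ []
      ≈⟨ ∑-++ (map (a ∷_) S₁) (map (b ∷_) S₂) δ [] ⟩
    ∑ (map (a ∷_) S₁) δ [] + ∑ (map (b ∷_) S₂) δ []
      ≈⟨ +-cong (∑-prefixed-[] a S₁) (∑-prefixed-[] b S₂) ⟩
    0# + 0#                         ≈⟨ +-identityˡ 0# ⟩
    0#                              ≈⟨ zeroˡ _ ⟨
    0# * δ (b ∷ v) []               ≈⟨ *-congʳ (kron-≢ λ ()) ⟨
    δ (a ∷ u) [] * δ (b ∷ v) []     ∎
    where
    open ≈-Reasoning
    S₁ S₂ : List Word
    S₁ = shuffleW u (b ∷ v)
    S₂ = shuffleW (a ∷ u) v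
  ∑-shuffleW (a ∷ u) (b ∷ v) (x ∷ w) = begin
    ∑ (map (a ∷_) S₁ ++ map (b ∷_) S₂) δ (x ∷ w)
      ≈⟨ ∑-++ (map (a ∷_) S₁) (map (b ∷_) S₂) δ (x ∷ w) ⟩
    ∂ x (∑ (map (a ∷_) S₁) δ) w + ∂ x (∑ (map (b ∷_) S₂) δ) w
      ≈⟨ +-cong (∂-∑-prefixed x a S₁ w) (∂-∑-prefixed x b S₂ w) ⟩
    kron _≟L_ a x * ∑ S₁ δ w + kron _≟L_ b x * ∑ S₂ δ w
      ≈⟨ +-cong (*-congˡ (∑-shuffleW u (b ∷ v) w)) (*-congˡ (∑-shuffleW (a ∷ u) v w)) ⟩
    kron _≟L_ a x * (δ u ⧢ δ (b ∷ v)) w + kron _≟L_ b x * (δ (a ∷ u) ⧢ δ v) w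
      ≈⟨ +-cong (·-hom (⧢-linearˡ _) _ (δ u) w) (·-hom (⧢-linearʳ _) _ (δ v) w) ⟨
    ((kron _≟L_ a x ·ˢ δ u) ⧢ δ (b ∷ v)) w + (δ (a ∷ u) ⧢ (kron _≟L_ b x ·ˢ δ v)) w
      ≈⟨ +-cong (⧢-cong (∂-δ x a u) (λ _ → refl) w) (⧢-cong (λ _ → refl) (∂-δ x b v) w) ⟨
    (∂ x (δ (a ∷ u)) ⧢ δ (b ∷ v)) w + (δ (a ∷ u) ⧢ ∂ x (δ (b ∷ v))) w
      ∎
    where
    open ≈-Reasoning
    S₁ S₂ : List Word
    S₁ = shuffleW u (b ∷ v)
    S₂ = shuffleW (a ∷ u) v

  -- The two-letter clause comes first so that the case split is on the tail, making
  -- (f ·Y) (a ∷ b ∷ w) reduce for a variable letter a.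
  infixl 8 _·Y
  _·Y : Series → Series
  (f ·Y) [] = 0#
  (f ·Y) (a ∷ b ∷ w) = (∂ a f ·Y) (b ∷ w)
  (f ·Y) (X ∷ []) = 0#
  (f ·Y) (Y ∷ []) = f []

  ·Y-linear : IsLinear _·Y
  ·Y-linear = record { cong = cong′ ; +-hom = hom-+ ; ·-hom = hom-· }
    where
    cong′ : ∀ {f g} → f ≋ g → f ·Y ≋ g ·Y
    cong′ f≋g [] = refl
    cong′ f≋g (X ∷ []) = refl
    cong′ f≋g (Y ∷ []) = f≋g []
    cong′ f≋g (a ∷ b ∷ w) = cong′ (f≋g ∘ (a ∷_)) (b ∷ w)
    hom-+ : ∀ f g → (f +ˢ g) ·Y ≋ f ·Y +ˢ g ·Y
    hom-+ f g [] = sym (+-identityˡ 0#)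
    hom-+ f g (X ∷ []) = sym (+-identityˡ 0#)
    hom-+ f g (Y ∷ []) = refl
    hom-+ f g (a ∷ b ∷ w) = hom-+ (∂ a f) (∂ a g) (b ∷ w)
    hom-· : ∀ k f → (k ·ˢ f) ·Y ≋ k ·ˢ f ·Y
    hom-· k f [] = sym (zeroʳ k)
    hom-· k f (X ∷ []) = sym (zeroʳ k)
    hom-· k f (Y ∷ []) = refl
    hom-· k f (a ∷ b ∷ w) = hom-· k (∂ a f) (b ∷ w)

  ∂X-·Y : ∀ f → ∂ X (f ·Y) ≋ ∂ X f ·Y
  ∂X-·Y f [] = refl
  ∂X-·Y f (b ∷ w) = refl

  ∂Y-·Y : ∀ f → ∂ Y (f ·Y) ≋ ∂ Y f ·Y +ˢ f [] ·ˢ δ []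
  ∂Y-·Y f [] = sym (trans (+-identityˡ _) (trans (*-congˡ (kron-refl [])) (*-identityʳ _)))
  ∂Y-·Y f (b ∷ w) = sym (trans (+-congˡ (trans (*-congˡ (kron-≢ λ ())) (zeroʳ _))) (+-identityʳ _))

  δ-++Y : ∀ u → δ (u ++ Y ∷ []) ≋ δ u ·Y
  δ-++Y u [] = kron-≢ (nonempty u)
    where
    nonempty : ∀ u → u ++ Y ∷ [] ≢ []
    nonempty [] ()
    nonempty (_ ∷ _) ()
  δ-++Y [] (X ∷ w) = trans (kron-≢ λ ()) (sym (begin
    (δ [] ·Y) (X ∷ w)   ≈⟨ ∂X-·Y (δ []) w ⟩
    (∂ X (δ []) ·Y) w   ≈⟨ cong-0 ·Y-linear (∂-δ[] X) w ⟩
    0#                  ∎))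
    where open ≈-Reasoning
  δ-++Y [] (Y ∷ w) = begin
    δ (Y ∷ []) (Y ∷ w)                        ≈⟨ ∂-δ Y Y [] w ⟩
    kron _≟L_ Y Y * δ [] w                    ≈⟨ *-congʳ (trans (kron-refl Y) (sym (kron-refl []))) ⟩
    δ [] [] * δ [] w                          ≈⟨ +-identityˡ _ ⟨
    0# + δ [] [] * δ [] w                     ≈⟨ +-congʳ (0-hom ·Y-linear w) ⟨
    (0ˢ ·Y) w + δ [] [] * δ [] w              ≈⟨ +-congʳ (cong ·Y-linear (∂-δ[] Y) w) ⟨
    (∂ Y (δ []) ·Y) w + δ [] [] * δ [] w      ≈⟨ ∂Y-·Y (δ []) w ⟨
    ∂ Y (δ [] ·Y) w                           ∎
    where open ≈-Reasoning
  δ-++Y (a ∷ u) (b ∷ w) = begin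
    δ (a ∷ u ++ Y ∷ []) (b ∷ w)        ≈⟨ ∂-δ b a (u ++ Y ∷ []) w ⟩
    kron _≟L_ a b * δ (u ++ Y ∷ []) w  ≈⟨ *-congˡ (δ-++Y u w) ⟩
    kron _≟L_ a b * (δ u ·Y) w         ≈⟨ ·-hom ·Y-linear _ (δ u) w ⟨
    ((kron _≟L_ a b ·ˢ δ u) ·Y) w      ≈⟨ cong ·Y-linear (∂-δ b a u) w ⟨
    (∂ b (δ (a ∷ u)) ·Y) w             ≈⟨ ∂-·Y b ⟨
    ∂ b (δ (a ∷ u) ·Y) w               ∎
    where
    open ≈-Reasoning
    ∂-·Y : ∀ b → ∂ b (δ (a ∷ u) ·Y) w ≈ (∂ b (δ (a ∷ u)) ·Y) w
    ∂-·Y X = ∂X-·Y (δ (a ∷ u)) w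
    ∂-·Y Y = trans (∂Y-·Y (δ (a ∷ u)) w)
                   (trans (+-congˡ (trans (*-congʳ (kron-≢ λ ())) (zeroˡ _))) (+-identityʳ _))

  VanishesOnXPowers : Series → Set ℓ
  VanishesOnXPowers f = ∀ n → f (Xpow n) ≈ 0#

  ·Y-vanishes : ∀ f → VanishesOnXPowers (f ·Y)
  ·Y-vanishes f zero = refl
  ·Y-vanishes f (suc zero) = refl
  ·Y-vanishes f (suc (suc n)) = ·Y-vanishes (∂ X f) (suc n)

  ⧢-vanishesˡ : ∀ {f} g → VanishesOnXPowers f → VanishesOnXPowers (f ⧢ g)
  ⧢-vanishesˡ g f-vanishes zero = trans (*-congʳ (f-vanishes 0)) (zeroˡ _)
  ⧢-vanishesˡ g f-vanishes (suc n) = trans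
    (+-cong (⧢-vanishesˡ g (f-vanishes ∘ suc) n) (⧢-vanishesˡ (∂ X g) f-vanishes n))
    (+-identityˡ 0#)

  demiStep : Series → ℕ → Series
  demiStep f k = (f ⧢ δ (Xpow k)) ·Y

  demiFold : Series → List ℕ → Series
  demiFold f [] = f
  demiFold f (k ∷ ks) = demiFold (demiStep f k) ks

  demiFrom : Series → Index → Series
  demiFrom f (ks , m) = demiFold f ks ⧢ δ (Xpow m)

  demiSeries : Index → Series
  demiSeries = demiFrom (δ [])

  demiStep-linear : ∀ k → IsLinear (λ f → demiStep f k)
  demiStep-linear k = ∘-linear ·Y-linear (⧢-linearˡ _)

  demiFold-linear : ∀ ks → IsLinear (λ f → demiFold f ks)
  demiFold-linear [] = record
    { cong = λ f≋g → f≋g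
    ; +-hom = λ _ _ _ → refl
    ; ·-hom = λ _ _ _ → refl
    }
  demiFold-linear (k ∷ ks) = ∘-linear (demiFold-linear ks) (demiStep-linear k)

  demiFrom-linear : ∀ t → IsLinear (λ f → demiFrom f t)
  demiFrom-linear (ks , m) = ∘-linear (⧢-linearˡ _) (demiFold-linear ks)

  ∂X-δXpow-suc : ∀ m → ∂ X (δ (Xpow (suc m))) ≋ δ (Xpow m)
  ∂X-δXpow-suc m w = trans (∂-δ X X (Xpow m) w) (trans (*-congʳ (kron-refl X)) (*-identityˡ _))

  ∂Y-δXpow : ∀ m → ∂ Y (δ (Xpow m)) ≋ 0ˢ
  ∂Y-δXpow zero = ∂-δ[] Y
  ∂Y-δXpow (suc m) w = trans (∂-δ Y X (Xpow m) w) (trans (*-congʳ (kron-≢ λ ())) (zeroˡ _))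

  δXpow-[] : ∀ k → δ (Xpow k) [] ≈ kron _≟_ k 0
  δXpow-[] zero = trans (kron-refl []) (sym (kron-refl 0))
  δXpow-[] (suc k) = trans (kron-≢ λ ()) (sym (kron-≢ λ ()))

  Xpow-injective : ∀ {m n} → Xpow m ≡ Xpow n → m ≡ n
  Xpow-injective {m} {n} eq =
    ≡.trans (≡.sym (length-replicate m)) (≡.trans (≡.cong length eq) (length-replicate n))

  ∂X-demiStep : ∀ f k → ∂ X (demiStep f k) ≋ demiStep (∂ X f) k +ˢ (f ⧢ ∂ X (δ (Xpow k))) ·Y
  ∂X-demiStep f k w =
    trans (∂X-·Y (f ⧢ δ (Xpow k)) w) (+-hom ·Y-linear (∂ X f ⧢ δ (Xpow k)) _ w)

  ∂Y-demiStep : ∀ f k → ∂ Y (demiStep f k) ≋ demiStep (∂ Y f) k +ˢ (f [] * δ (Xpow k) []) ·ˢ δ []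
  ∂Y-demiStep f k w = begin
    ∂ Y (demiStep f k) w
      ≈⟨ ∂Y-·Y (f ⧢ δ (Xpow k)) w ⟩
    ((∂ Y f ⧢ δ (Xpow k) +ˢ f ⧢ ∂ Y (δ (Xpow k))) ·Y) w + (f [] * δ (Xpow k) []) * δ [] w
      ≈⟨ +-congʳ (cong ·Y-linear vanish w) ⟩
    demiStep (∂ Y f) k w + (f [] * δ (Xpow k) []) * δ [] w
      ∎
    where
    open ≈-Reasoning
    vanish : ∂ Y f ⧢ δ (Xpow k) +ˢ f ⧢ ∂ Y (δ (Xpow k)) ≋ ∂ Y f ⧢ δ (Xpow k)
    vanish v = trans (+-congˡ (cong-0 (⧢-linearʳ f) (∂Y-δXpow k) v)) (+-identityʳ _)

  ∂X-demiStep-zero : ∀ f → ∂ X (demiStep f zero) ≋ demiStep (∂ X f) zero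
  ∂X-demiStep-zero f w = trans (∂X-demiStep f zero w)
    (trans (+-congˡ (cong-0 ·Y-linear (cong-0 (⧢-linearʳ f) (∂-δ[] X)) w)) (+-identityʳ _))

  ∂X-demiStep-suc : ∀ f k → ∂ X (demiStep f (suc k)) ≋ demiStep (∂ X f) (suc k) +ˢ demiStep f k
  ∂X-demiStep-suc f k w = trans (∂X-demiStep f (suc k) w)
    (+-congˡ (cong ·Y-linear (cong (⧢-linearʳ f) (∂X-δXpow-suc k)) w))

  infixr 5 _∷ᴵ_
  _∷ᴵ_ : ℕ → Index → Index
  k ∷ᴵ (ks , m) = (k ∷ ks , m)

  ∷ᴵ-injective : ∀ {k k′ t t′} → k ∷ᴵ t ≡ k′ ∷ᴵ t′ → k ≡ k′ × t ≡ t′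
  ∷ᴵ-injective {t = ts , m} {t′ = ts′ , m′} ≡.refl = ≡.refl , ≡.refl

  decrements : Index → List Index
  decrements ([] , zero) = []
  decrements ([] , suc m) = ([] , m) ∷ []
  decrements (zero ∷ ks , m) = map (zero ∷ᴵ_) (decrements (ks , m))
  decrements (suc k ∷ ks , m) = (k ∷ ks , m) ∷ map (suc k ∷ᴵ_) (decrements (ks , m))

  ∂X-demiFrom : ∀ f t → ∂ X (demiFrom f t) ≋ demiFrom (∂ X f) t +ˢ ∑ (decrements t) (demiFrom f)
  ∂X-demiFrom f ([] , zero) w = +-congˡ (cong-0 (⧢-linearʳ f) (∂-δ[] X) w)
  ∂X-demiFrom f ([] , suc m) w =
    +-congˡ (trans (cong (⧢-linearʳ f) (∂X-δXpow-suc m) w) (sym (+-identityʳ _)))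
  ∂X-demiFrom f (zero ∷ ks , m) w = trans (∂X-demiFrom (demiStep f zero) (ks , m) w)
    (+-cong (cong (demiFrom-linear (ks , m)) (∂X-demiStep-zero f) w)
            (sym (∑-map (zero ∷ᴵ_) (decrements (ks , m)) (demiFrom f) w)))
  ∂X-demiFrom f (suc k ∷ ks , m) w = begin
    ∂ X (demiFrom (demiStep f (suc k)) (ks , m)) w
      ≈⟨ ∂X-demiFrom (demiStep f (suc k)) (ks , m) w ⟩
    demiFrom (∂ X (demiStep f (suc k))) (ks , m) w + ∑ D (demiFrom (demiStep f (suc k))) w
      ≈⟨ +-cong (trans (cong L (∂X-demiStep-suc f k) w) (+-hom L _ _ w))
                (sym (∑-map (suc k ∷ᴵ_) D (demiFrom f) w)) ⟩
    (demiFrom (∂ X f) (suc k ∷ ks , m) w + demiFrom f (k ∷ ks , m) w)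
      + ∑ (map (suc k ∷ᴵ_) D) (demiFrom f) w
      ≈⟨ +-assoc _ _ _ ⟩
    demiFrom (∂ X f) (suc k ∷ ks , m) w + ∑ (decrements (suc k ∷ ks , m)) (demiFrom f) w
      ∎
    where
    open ≈-Reasoning
    D : List Index
    D = decrements (ks , m)
    L : IsLinear (λ f → demiFrom f (ks , m))
    L = demiFrom-linear (ks , m)

  ∂Y-demiFrom : ∀ f t → f [] ≈ 0# → ∂ Y (demiFrom f t) ≋ demiFrom (∂ Y f) t
  ∂Y-demiFrom f ([] , m) f[]≈0 w =
    trans (+-congˡ (cong-0 (⧢-linearʳ f) (∂Y-δXpow m) w)) (+-identityʳ _)
  ∂Y-demiFrom f (k ∷ ks , m) f[]≈0 w =
    trans (∂Y-demiFrom (demiStep f k) (ks , m) refl w) (cong (demiFrom-linear (ks , m)) ∂Y-step w)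
    where
    ∂Y-step : ∂ Y (demiStep f k) ≋ demiStep (∂ Y f) k
    ∂Y-step v = trans (∂Y-demiStep f k v) (trans (+-congˡ
      (trans (*-congʳ (trans (*-congʳ f[]≈0) (zeroˡ _))) (zeroˡ _))) (+-identityʳ _))

  ∂Y-demiSeries-[] : ∀ m → ∂ Y (demiSeries ([] , m)) ≋ 0ˢ
  ∂Y-demiSeries-[] m w = trans (⧢-identityˡ (δ (Xpow m)) (Y ∷ w)) (∂Y-δXpow m w)

  ∂Y-demiSeries-∷ : ∀ k ks m → ∂ Y (demiSeries (k ∷ ks , m)) ≋ kron _≟_ k 0 ·ˢ demiSeries (ks , m)
  ∂Y-demiSeries-∷ k ks m w = begin
    ∂ Y (demiFrom (demiStep (δ []) k) (ks , m)) w
      ≈⟨ ∂Y-demiFrom (demiStep (δ []) k) (ks , m) refl w ⟩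
    demiFrom (∂ Y (demiStep (δ []) k)) (ks , m) w
      ≈⟨ cong L (∂Y-demiStep (δ []) k) w ⟩
    demiFrom (demiStep (∂ Y (δ [])) k +ˢ κ ·ˢ δ []) (ks , m) w
      ≈⟨ +-hom L _ _ w ⟩
    demiFrom (demiStep (∂ Y (δ [])) k) (ks , m) w + demiFrom (κ ·ˢ δ []) (ks , m) w
      ≈⟨ +-cong (cong-0 L (cong-0 (demiStep-linear k) (∂-δ[] Y)) w) (·-hom L κ (δ []) w) ⟩
    0# + κ * demiSeries (ks , m) w
      ≈⟨ +-identityˡ _ ⟩
    κ * demiSeries (ks , m) w
      ≈⟨ *-congʳ (trans (*-congʳ (kron-refl [])) (*-identityˡ _)) ⟩
    δ (Xpow k) [] * demiSeries (ks , m) w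
      ≈⟨ *-congʳ (δXpow-[] k) ⟩
    kron _≟_ k 0 * demiSeries (ks , m) w
      ∎
    where
    open ≈-Reasoning
    κ : Carrier
    κ = δ [] [] * δ (Xpow k) []
    L : IsLinear (λ f → demiFrom f (ks , m))
    L = demiFrom-linear (ks , m)

  ∂X-demiSeries : ∀ t → ∂ X (demiSeries t) ≋ ∑ (decrements t) demiSeries
  ∂X-demiSeries t w = trans (∂X-demiFrom (δ []) t w)
    (trans (+-congʳ (cong-0 (demiFrom-linear t) (∂-δ[] X) w)) (+-identityˡ _))

  demiFrom-vanishes : ∀ {f} t → VanishesOnXPowers f → VanishesOnXPowers (demiFrom f t)
  demiFrom-vanishes ([] , m) f-vanishes = ⧢-vanishesˡ _ f-vanishes
  demiFrom-vanishes (k ∷ ks , m) f-vanishes = demiFrom-vanishes (ks , m) (·Y-vanishes _)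

  demiSeries-Xpow : ∀ t n → demiSeries t (Xpow n) ≈ δI R t ([] , n)
  demiSeries-Xpow ([] , m) n = trans (⧢-identityˡ (δ (Xpow m)) (Xpow n))
    (trans (kron-cong (mk⇔ (≡.cong ([] ,_) ∘ Xpow-injective) (≡.cong (Xpow ∘ proj₂))))
           (sym (reflexive (δI≡kron ([] , m) ([] , n)))))
  demiSeries-Xpow (k ∷ ks , m) n = trans (demiFrom-vanishes (ks , m) (·Y-vanishes _) n)
    (sym (trans (reflexive (δI≡kron (k ∷ ks , m) ([] , n))) (kron-≢ λ ())))

  monomial : Carrier × Word → Series
  monomial (a , u) = a ·ˢ δ u

  coeff : Poly R → Series
  coeff p = ∑ p monomial

  coeff-word : ∀ u → coeff (word R u) ≋ δ u
  coeff-word u w = trans (+-identityʳ _) (*-identityˡ _)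

  coeff-concatMap : ∀ {a} {A : Set a} (g : A → Poly R) (L : List A) {h : A → Series} →
                    (∀ x → coeff (g x) ≋ h x) → coeff (concatMap g L) ≋ ∑ L h
  coeff-concatMap g L coeff-g w = trans (∑-concatMap g L monomial w) (∑-cong L coeff-g w)

  coeff-shuffleW : ∀ a u b v →
                   coeff (map (λ w → (a * b , w)) (shuffleW u v)) ≋ monomial (a , u) ⧢ monomial (b , v)
  coeff-shuffleW a u b v = begin
    coeff (map (λ w → (a * b , w)) (shuffleW u v))  ≈⟨ ∑-map _ (shuffleW u v) monomial ⟩
    ∑ (shuffleW u v) (λ w → (a * b) ·ˢ δ w)         ≈⟨ ∑-hom (·ˢ-linear (a * b)) (shuffleW u v) δ ⟨
    (a * b) ·ˢ ∑ (shuffleW u v) δ                   ≈⟨ cong (·ˢ-linear (a * b)) (∑-shuffleW u v) ⟩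
    (a * b) ·ˢ (δ u ⧢ δ v)                          ≈⟨ (λ w → *-assoc a b _) ⟩
    a ·ˢ b ·ˢ (δ u ⧢ δ v)
      ≈⟨ cong (·ˢ-linear a) (·-hom (⧢-linearʳ (δ u)) b (δ v)) ⟨
    a ·ˢ (δ u ⧢ b ·ˢ δ v)                           ≈⟨ ·-hom (⧢-linearˡ _) a (δ u) ⟨
    (a ·ˢ δ u) ⧢ (b ·ˢ δ v)                         ∎
    where open ≋-Reasoning

  coeff-ш : ∀ p q → coeff (_ш_ R p q) ≋ coeff p ⧢ coeff q
  coeff-ш p q = begin
    coeff (_ш_ R p q)
      ≈⟨ coeff-concatMap _ p (λ (a , u) → coeff-concatMap _ q (λ (b , v) → coeff-shuffleW a u b v)) ⟩
    ∑ p (λ x → ∑ q (λ y → monomial x ⧢ monomial y))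
      ≈⟨ ∑-cong p (λ x → ∑-hom (⧢-linearʳ (monomial x)) q monomial) ⟨
    ∑ p (λ x → monomial x ⧢ coeff q)
      ≈⟨ ∑-hom (⧢-linearˡ (coeff q)) p monomial ⟨
    coeff p ⧢ coeff q
      ∎
    where open ≋-Reasoning

  coeff-⊗Y : ∀ p → coeff (_⊗_ R p (word R (Y ∷ []))) ≋ coeff p ·Y
  coeff-⊗Y p = begin
    coeff (_⊗_ R p (word R (Y ∷ [])))  ≈⟨ coeff-concatMap _ p monomial-⊗Y ⟩
    ∑ p (λ x → monomial x ·Y)          ≈⟨ ∑-hom ·Y-linear p monomial ⟨
    coeff p ·Y                         ∎
    where
    open ≋-Reasoning
    monomial-⊗Y : ∀ x → coeff ((proj₁ x * 1# , proj₂ x ++ Y ∷ []) ∷ []) ≋ monomial x ·Y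
    monomial-⊗Y (a , u) w = trans (+-identityʳ _)
      (trans (*-cong (*-identityʳ a) (δ-++Y u w)) (sym (·-hom ·Y-linear a (δ u) w)))

  demiStepPoly : Poly R → ℕ → Poly R
  demiStepPoly P k = _⊗_ R (_ш_ R P (word R (Xpow k))) (word R (Y ∷ []))

  coeff-demiStepPoly : ∀ P k → coeff (demiStepPoly P k) ≋ demiStep (coeff P) k
  coeff-demiStepPoly P k w = trans (coeff-⊗Y (_ш_ R P (word R (Xpow k))) w)
    (cong ·Y-linear (λ v → trans (coeff-ш P (word R (Xpow k)) v) (cong (⧢-linearʳ _) (coeff-word _) v)) w)

  coeff-foldl : ∀ ks P → coeff (foldl demiStepPoly P ks) ≋ demiFold (coeff P) ks
  coeff-foldl [] P w = refl
  coeff-foldl (k ∷ ks) P w = trans (coeff-foldl ks (demiStepPoly P k) w)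
    (cong (demiFold-linear ks) (coeff-demiStepPoly P k) w)

  coeff-DemiShuffle : ∀ t → coeff (DemiShuffle R t) ≋ demiSeries t
  coeff-DemiShuffle (ks , m) w = trans (coeff-ш (foldl demiStepPoly (one R) ks) (word R (Xpow m)) w)
    (⧢-cong (λ v → trans (coeff-foldl ks (one R) v) (cong (demiFold-linear ks) (coeff-word []) v))
            (coeff-word (Xpow m)) w)

  ⟨_,_⟩ : Series → Poly R → Carrier
  ⟨ f , [] ⟩ = 0#
  ⟨ f , (b , v) ∷ q ⟩ = f v * b + ⟨ f , q ⟩

  ⟨⟩-cong : ∀ {f g} → f ≋ g → ∀ q → ⟨ f , q ⟩ ≈ ⟨ g , q ⟩
  ⟨⟩-cong f≋g [] = refl
  ⟨⟩-cong f≋g ((b , v) ∷ q) = +-cong (*-congʳ (f≋g v)) (⟨⟩-cong f≋g q)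

  ⟨⟩-0ˢ : ∀ q → ⟨ 0ˢ , q ⟩ ≈ 0#
  ⟨⟩-0ˢ [] = refl
  ⟨⟩-0ˢ ((b , v) ∷ q) = trans (+-cong (zeroˡ b) (⟨⟩-0ˢ q)) (+-identityˡ 0#)

  ⟨⟩-+ˢ : ∀ f g q → ⟨ f +ˢ g , q ⟩ ≈ ⟨ f , q ⟩ + ⟨ g , q ⟩
  ⟨⟩-+ˢ f g [] = sym (+-identityˡ 0#)
  ⟨⟩-+ˢ f g ((b , v) ∷ q) = trans (+-cong (distribʳ b _ _) (⟨⟩-+ˢ f g q)) (interchange _ _ _ _)

  ⟨⟩-·ˢ : ∀ a f q → ⟨ a ·ˢ f , q ⟩ ≈ a * ⟨ f , q ⟩
  ⟨⟩-·ˢ a f [] = sym (zeroʳ a)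
  ⟨⟩-·ˢ a f ((b , v) ∷ q) = trans (+-cong (*-assoc a _ b) (⟨⟩-·ˢ a f q)) (sym (distribˡ a _ _))

  ⟨⟩-++ : ∀ f p q → ⟨ f , p ++ q ⟩ ≈ ⟨ f , p ⟩ + ⟨ f , q ⟩
  ⟨⟩-++ f [] q = sym (+-identityˡ _)
  ⟨⟩-++ f ((b , v) ∷ p) q = trans (+-congˡ (⟨⟩-++ f p q)) (sym (+-assoc _ _ _))

  ⟨⟩-neg : ∀ f p → ⟨ f , neg R p ⟩ ≈ - ⟨ f , p ⟩
  ⟨⟩-neg f [] = sym ε⁻¹≈ε
  ⟨⟩-neg f ((b , v) ∷ p) =
    trans (+-cong (sym (-‿distribʳ-* (f v) b)) (⟨⟩-neg f p)) (⁻¹-∙-comm _ _)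

  ⟨⟩-word : ∀ f w → ⟨ f , word R w ⟩ ≈ f w
  ⟨⟩-word f w = trans (+-identityʳ _) (*-identityʳ _)

  ⟨⟩-⊗ : ∀ f p q → ⟨ f , _⊗_ R p q ⟩ ≈ ⟨ (λ u → ⟨ (λ v → f (u ++ v)) , q ⟩) , p ⟩
  ⟨⟩-⊗ f [] q = refl
  ⟨⟩-⊗ f ((a , u) ∷ p) q =
    trans (⟨⟩-++ f (map _ q) (_⊗_ R p q)) (+-cong (left-factor q) (⟨⟩-⊗ f p q))
    where
    left-factor : ∀ q′ → ⟨ f , map (λ { (b , v) → (a * b , u ++ v) }) q′ ⟩
                       ≈ ⟨ (λ v → f (u ++ v)) , q′ ⟩ * a
    left-factor [] = sym (zeroˡ a)
    left-factor ((b , v) ∷ q′) = trans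
      (+-cong (trans (*-congˡ (*-comm a b)) (sym (*-assoc _ b a))) (left-factor q′))
      (sym (distribʳ a _ _))

  ⟨⟩-swap : ∀ (F : Word → Word → Carrier) p q →
            ⟨ (λ u → ⟨ F u , q ⟩) , p ⟩ ≈ ⟨ (λ v → ⟨ (λ u → F u v) , p ⟩) , q ⟩
  ⟨⟩-swap F [] q = sym (⟨⟩-0ˢ q)
  ⟨⟩-swap F ((a , u) ∷ p) q = begin
    ⟨ F u , q ⟩ * a + ⟨ (λ u′ → ⟨ F u′ , q ⟩) , p ⟩
      ≈⟨ +-cong (trans (*-comm _ a) (sym (⟨⟩-·ˢ a (F u) q))) (⟨⟩-swap F p q) ⟩
    ⟨ a ·ˢ F u , q ⟩ + ⟨ (λ v → ⟨ (λ u′ → F u′ v) , p ⟩) , q ⟩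
      ≈⟨ ⟨⟩-+ˢ _ _ q ⟨
    ⟨ (λ v → a * F u v + ⟨ (λ u′ → F u′ v) , p ⟩) , q ⟩
      ≈⟨ ⟨⟩-cong (λ v → +-congʳ (*-comm a _)) q ⟩
    ⟨ (λ v → ⟨ (λ u′ → F u′ v) , (a , u) ∷ p ⟩) , q ⟩
      ∎
    where open ≈-Reasoning

  pairing≈⟨coeff⟩ : ∀ p q → ⟪_,_⟫ R p q ≈ ⟨ coeff p , q ⟩
  pairing≈⟨coeff⟩ [] q = sym (⟨⟩-0ˢ q)
  pairing≈⟨coeff⟩ ((a , u) ∷ p) q =
    trans (sumR-++ (map _ q) _)
      (trans (+-cong (term q) (pairing≈⟨coeff⟩ p q)) (sym (⟨⟩-+ˢ (a ·ˢ δ u) (coeff p) q)))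
    where
    sumR-++ : ∀ xs ys → sumR R (xs ++ ys) ≈ sumR R xs + sumR R ys
    sumR-++ [] ys = sym (+-identityˡ _)
    sumR-++ (x ∷ xs) ys = trans (+-congˡ (sumR-++ xs ys)) (sym (+-assoc _ _ _))
    term : ∀ q′ → sumR R (map (λ { (b , v) → a * b * δW R u v }) q′) ≈ ⟨ a ·ˢ δ u , q′ ⟩
    term [] = refl
    term ((b , v) ∷ q′) =
      +-cong (trans (xy∙z≈xz∙y a b _) (*-congʳ (*-congˡ (reflexive (δW≡kron u v))))) (term q′)

  infixr 6 _⊳_
  _⊳_ : Poly R → Series → Series
  (p ⊳ f) v = ⟨ (λ u → f (u ++ v)) , p ⟩

  ⊳-linear : ∀ p → IsLinear (p ⊳_)
  ⊳-linear p = record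
    { cong = λ f≋g v → ⟨⟩-cong (λ u → f≋g (u ++ v)) p
    ; +-hom = λ f g v → ⟨⟩-+ˢ _ _ p
    ; ·-hom = λ a f v → ⟨⟩-·ˢ a _ p
    }

  ⟨⟩-⊗-⊳ : ∀ f p q → ⟨ f , _⊗_ R p q ⟩ ≈ ⟨ p ⊳ f , q ⟩
  ⟨⟩-⊗-⊳ f p q = trans (⟨⟩-⊗ f p q) (⟨⟩-swap (λ u v → f (u ++ v)) p q)

  Yder-zero-⊳ : ∀ f → Yder R zero ⊳ f ≋ ∂ Y f
  Yder-zero-⊳ f v = ⟨⟩-word (λ u → f (u ++ v)) (Y ∷ [])

  Yder-suc-⊳ : ∀ k f v → (Yder R (suc k) ⊳ f) v ≈ (Yder R k ⊳ ∂ X f) v - (Yder R k ⊳ f) (X ∷ v)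
  Yder-suc-⊳ k f v = begin
    ⟨ g , _⊗_ R [X] Yk ++ neg R (_⊗_ R Yk [X]) ⟩
      ≈⟨ ⟨⟩-++ g (_⊗_ R [X] Yk) _ ⟩
    ⟨ g , _⊗_ R [X] Yk ⟩ + ⟨ g , neg R (_⊗_ R Yk [X]) ⟩
      ≈⟨ +-cong (⟨⟩-⊗ g [X] Yk) (⟨⟩-neg g (_⊗_ R Yk [X])) ⟩
    ⟨ (λ u → ⟨ (λ u′ → g (u ++ u′)) , Yk ⟩) , [X] ⟩ - ⟨ g , _⊗_ R Yk [X] ⟩
      ≈⟨ +-cong (⟨⟩-word (λ u → ⟨ (λ u′ → g (u ++ u′)) , Yk ⟩) (X ∷ []))
                (-‿cong (trans (⟨⟩-⊗ g Yk [X]) (⟨⟩-cong ·[X] Yk))) ⟩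
    (Yk ⊳ ∂ X f) v - (Yk ⊳ f) (X ∷ v)
      ∎
    where
    open ≈-Reasoning
    Yk [X] : Poly R
    Yk = Yder R k
    [X] = word R (X ∷ [])
    g : Series
    g u = f (u ++ v)
    ·[X] : ∀ u → ⟨ (λ u′ → g (u ++ u′)) , [X] ⟩ ≈ f (u ++ X ∷ v)
    ·[X] u = trans (⟨⟩-word (λ u′ → g (u ++ u′)) (X ∷ []))
                   (reflexive (≡.cong f (++-assoc u (X ∷ []) v)))

  contract : ℕ → Index → Series
  contract k ([] , m) = 0ˢ
  contract k (t₁ ∷ ts , m) = kron _≟_ t₁ k ·ˢ demiSeries (ts , m)

  ∑-∷ᴵ-contract : ∀ t₁ k t →
                  ∑ (map (t₁ ∷ᴵ_) (decrements t)) (contract k) ≋ ∂ X (contract k (t₁ ∷ᴵ t))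
  ∑-∷ᴵ-contract t₁ k t w = begin
    ∑ (map (t₁ ∷ᴵ_) (decrements t)) (contract k) w
      ≈⟨ ∑-map (t₁ ∷ᴵ_) (decrements t) (contract k) w ⟩
    ∑ (decrements t) (λ t′ → κ ·ˢ demiSeries t′) w
      ≈⟨ ∑-hom (·ˢ-linear κ) (decrements t) demiSeries w ⟨
    κ * ∑ (decrements t) demiSeries w
      ≈⟨ *-congˡ (∂X-demiSeries t w) ⟨
    κ * demiSeries t (X ∷ w)
      ∎
    where
    open ≈-Reasoning
    κ : Carrier
    κ = kron _≟_ t₁ k

  ∑-decrements-contract : ∀ k t →
                          ∑ (decrements t) (contract k) ≋ contract (suc k) t +ˢ ∂ X (contract k t)
  ∑-decrements-contract k ([] , zero) w = sym (+-identityˡ 0#)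
  ∑-decrements-contract k ([] , suc m) w = refl
  ∑-decrements-contract k (zero ∷ ts , m) w = trans (∑-∷ᴵ-contract zero k (ts , m) w)
    (sym (trans (+-congʳ (trans (*-congʳ (kron-≢ λ ())) (zeroˡ _))) (+-identityˡ _)))
  ∑-decrements-contract k (suc j ∷ ts , m) w =
    +-cong (*-congʳ (kron-cong (mk⇔ (≡.cong suc) suc-injective))) (∑-∷ᴵ-contract (suc j) k (ts , m) w)

  Yder-⊳-demiSeries : ∀ k t → Yder R k ⊳ demiSeries t ≋ contract k t
  Yder-⊳-demiSeries zero ([] , m) w = trans (Yder-zero-⊳ (demiSeries ([] , m)) w) (∂Y-demiSeries-[] m w)
  Yder-⊳-demiSeries zero (t₁ ∷ ts , m) w =
    trans (Yder-zero-⊳ (demiSeries (t₁ ∷ ts , m)) w) (∂Y-demiSeries-∷ t₁ ts m w)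
  Yder-⊳-demiSeries (suc k) t w = begin
    (Yder R (suc k) ⊳ demiSeries t) w
      ≈⟨ Yder-suc-⊳ k (demiSeries t) w ⟩
    (Yder R k ⊳ ∂ X (demiSeries t)) w - (Yder R k ⊳ demiSeries t) (X ∷ w)
      ≈⟨ +-cong (trans (cong L (∂X-demiSeries t) w)
                (trans (∑-hom L (decrements t) demiSeries w)
                       (∑-cong (decrements t) (Yder-⊳-demiSeries k) w)))
                (-‿cong (Yder-⊳-demiSeries k t (X ∷ w))) ⟩
    ∑ (decrements t) (contract k) w - contract k t (X ∷ w)
      ≈⟨ +-congʳ (∑-decrements-contract k t w) ⟩
    (contract (suc k) t w + contract k t (X ∷ w)) - contract k t (X ∷ w)
      ≈⟨ +-assoc _ _ _ ⟩
    contract (suc k) t w + (contract k t (X ∷ w) - contract k t (X ∷ w))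
      ≈⟨ +-congˡ (-‿inverseʳ _) ⟩
    contract (suc k) t w + 0#
      ≈⟨ +-identityʳ _ ⟩
    contract (suc k) t w
      ∎
    where
    open ≈-Reasoning
    L : IsLinear (Yder R k ⊳_)
    L = ⊳-linear (Yder R k)

  ⟨demiSeries,Magnus⟩ : ∀ ks m t → ⟨ demiSeries t , Magnus R (ks , m) ⟩ ≈ δI R t (ks , m)
  ⟨demiSeries,Magnus⟩ [] m t = trans (⟨⟩-word (demiSeries t) (Xpow m)) (demiSeries-Xpow t m)
  ⟨demiSeries,Magnus⟩ (k ∷ ks) m t = begin
    ⟨ demiSeries t , _⊗_ R (Yder R k) (Magnus R (ks , m)) ⟩
      ≈⟨ ⟨⟩-⊗-⊳ (demiSeries t) (Yder R k) (Magnus R (ks , m)) ⟩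
    ⟨ Yder R k ⊳ demiSeries t , Magnus R (ks , m) ⟩
      ≈⟨ ⟨⟩-cong (Yder-⊳-demiSeries k t) (Magnus R (ks , m)) ⟩
    ⟨ contract k t , Magnus R (ks , m) ⟩
      ≈⟨ ⟨contract,Magnus⟩ t ⟩
    δI R t (k ∷ ks , m)
      ∎
    where
    open ≈-Reasoning
    ⟨contract,Magnus⟩ : ∀ t → ⟨ contract k t , Magnus R (ks , m) ⟩ ≈ δI R t (k ∷ ks , m)
    ⟨contract,Magnus⟩ ([] , m′) = trans (⟨⟩-0ˢ (Magnus R (ks , m)))
      (sym (trans (reflexive (δI≡kron ([] , m′) (k ∷ ks , m))) (kron-≢ λ ())))
    ⟨contract,Magnus⟩ (t₁ ∷ ts , m′) = begin
      ⟨ kron _≟_ t₁ k ·ˢ demiSeries (ts , m′) , Magnus R (ks , m) ⟩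
        ≈⟨ ⟨⟩-·ˢ _ (demiSeries (ts , m′)) (Magnus R (ks , m)) ⟩
      kron _≟_ t₁ k * ⟨ demiSeries (ts , m′) , Magnus R (ks , m) ⟩
        ≈⟨ *-congˡ (⟨demiSeries,Magnus⟩ ks m (ts , m′)) ⟩
      kron _≟_ t₁ k * δI R (ts , m′) (ks , m)
        ≈⟨ *-congˡ (reflexive (δI≡kron (ts , m′) (ks , m))) ⟩
      kron _≟_ t₁ k * kron _≟I_ (ts , m′) (ks , m)
        ≈⟨ kron-injective₂ _∷ᴵ_ ∷ᴵ-injective t₁ (ts , m′) k (ks , m) ⟨
      kron _≟I_ (t₁ ∷ ts , m′) (k ∷ ks , m)
        ≈⟨ reflexive (δI≡kron (t₁ ∷ ts , m′) (k ∷ ks , m)) ⟨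
      δI R (t₁ ∷ ts , m′) (k ∷ ks , m)
        ∎

-- The integral-domain and characteristic-zero hypotheses are unused: the duality holds
-- over every commutative ring.
theorem2p4 : {c ℓ : Level} (R : CommutativeRing c ℓ) →
    IsIntegralDomain R → HasCharZero R →
    (t k : Index) →
    CommutativeRing._≈_ R (⟪_,_⟫ R (DemiShuffle R t) (Magnus R k)) (δI R t k)
theorem2p4 R _ _ t (ks , m) = begin
  ⟪_,_⟫ R (DemiShuffle R t) (Magnus R (ks , m))   ≈⟨ pairing≈⟨coeff⟩ R (DemiShuffle R t) _ ⟩
  ⟨_,_⟩ R (coeff R (DemiShuffle R t)) (Magnus R (ks , m))
    ≈⟨ ⟨⟩-cong R (coeff-DemiShuffle R t) (Magnus R (ks , m)) ⟩
  ⟨_,_⟩ R (demiSeries R t) (Magnus R (ks , m))   ≈⟨ ⟨demiSeries,Magnus⟩ R ks m t ⟩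
  δI R t (ks , m)                                ∎
  where open SetoidReasoning (CommutativeRing.setoid R)
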